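{- If a generalised clause-set $F$ is minimally unsatisfiable, then $\delta^*(F)=\delta(F)\ge 1$.
   Context: Each variable $v$ has a finite non-empty domain $D_v$; a literal is a pair $(v,\varepsilon)$, $\varepsilon\in D_v$, meaning "$v\ne\varepsilon$"; a clause is a finite set of literals with no two distinct literals on the same variable; a clause-set is a finite set of clauses; it is satisfiable iff some assignment of values satisfies (makes true some literal of) every clause, and minimally unsatisfiable iff unsatisfiable while all proper subsets are satisfiable. $c(F)=|F|$, $\mathrm{rd}(F)=\sum_{v\in\mathrm{var}(F)}(|D_v|-1)$, $\delta(F)=c(F)-\mathrm{rd}(F)$, $\delta^*(F)=\max_{F'\subseteq F}\delta(F')$. -}

module Defs where

open import Data.Nat using (ℕ; _∸_; _<_; NonZero)
open import Data.Nat.Properties using () renaming (_≟_ to _≟ℕ_)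
open import Data.Fin using (Fin)
open import Data.Integer using (ℤ; +_; _-_; _⊔_)
open import Data.List using (List; []; _∷_; map; concatMap; length; foldr; deduplicate; _++_)
open import Data.Nat.ListAction using (sum)
open import Data.List.Membership.Propositional using (_∈_)
open import Data.List.Relation.Unary.All using (All)
open import Data.List.Relation.Unary.Any using (Any)
open import Data.List.Relation.Unary.AllPairs using (AllPairs)
open import Data.List.Relation.Unary.Unique.Propositional using (Unique)
open import Data.List.Relation.Binary.Sublist.Propositional using (_⊆_)
open import Data.Product using (Σ; ∃; _×_; proj₁; _,_)
open import Relation.Binary.PropositionalEquality using (_≡_; _≢_)
open import Relation.Nullary using (¬_)
open import Function.Bundles using (_⇔_)

-- Variables are natural numbers; a domain assignment  dom  gives |D_v| = dom v,
-- with D_v = Fin (dom v).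
Domains : Set
Domains = ℕ → ℕ

module _ (dom : Domains) where

  -- literal (v , ε) means "v ≠ ε"
  Literal : Set
  Literal = Σ ℕ (λ v → Fin (dom v))

  Clause : Set
  Clause = List Literal

  ClauseSet : Set
  ClauseSet = List Clause

  WFClause : Clause → Set
  WFClause C = Unique C × (∀ {l₁ l₂} → l₁ ∈ C → l₂ ∈ C → proj₁ l₁ ≡ proj₁ l₂ → l₁ ≡ l₂)

  SameClause : Clause → Clause → Set
  SameClause C D = ∀ l → (l ∈ C) ⇔ (l ∈ D)

  WFClauseSet : ClauseSet → Set
  WFClauseSet F = All WFClause F × AllPairs (λ C D → ¬ SameClause C D) F

  Assignment : Set
  Assignment = (v : ℕ) → Fin (dom v)

  SatLit : Assignment → Literal → Set
  SatLit φ (v , ε) = φ v ≢ ε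

  SatClause : Assignment → Clause → Set
  SatClause φ C = Any (SatLit φ) C

  Satisfiable : ClauseSet → Set
  Satisfiable F = ∃ λ (φ : Assignment) → All (SatClause φ) F

  MinUnsat : ClauseSet → Set
  MinUnsat F = ¬ Satisfiable F × (∀ F' → F' ⊆ F → length F' < length F → Satisfiable F')

  vars : ClauseSet → List ℕ
  vars F = deduplicate _≟ℕ_ (concatMap (map proj₁) F)

  c : ClauseSet → ℕ
  c F = length F

  rd : ClauseSet → ℕ
  rd F = sum (map (λ v → dom v ∸ 1) (vars F))

  δ : ClauseSet → ℤ
  δ F = + c F - + rd F

sublists : ∀ {A : Set} → List A → List (List A)
sublists [] = [] ∷ []
sublists (x ∷ xs) = map (x ∷_) (sublists xs) ++ sublists xs

-- δ*(F) = max over F' ⊆ F of δ(F'); the empty subset (δ = 0) is always among them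
δ* : (dom : Domains) → ClauseSet dom → ℤ
δ* dom F = foldr _⊔_ (+ 0) (map (δ dom) (sublists F))

module Submission where

-- Let δ(s) be the deficiency of the clauses of F indexed by s. If s is satisfiable but F is not, a
-- satisfying assignment of s does not extend to the remaining clauses. By a Hall-type theorem, in which
-- every clause must be served by one of its variables and a variable v not occurring in s can serve up
-- to |D_v| − 1 clauses (its value only has to avoid their forbidden values), the obstruction is a set t
-- of remaining clauses offering fewer than |t| units of such capacity, i.e. δ(s ∪ t) > δ(s). When F is
-- minimally unsatisfiable every proper s is satisfiable, so growing a proper s with δ(s) ≥ δ(F) in this
-- way would reach F with δ(F) > δ(F). Hence δ(s) < δ(F) for every proper s: taking s = ∅ gives
-- δ(F) ≥ 1, and the maximum over all s is δ(F).

open import Defs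
open import Data.Nat using (ℕ; zero; suc; _+_; _∸_; _≤_; _<_; z≤n; s≤s; _≟_; _<?_; _≤?_; NonZero; >-nonZero⁻¹)
open import Data.Nat.Properties
open import Data.Nat.ListAction using (sum)
open import Data.Nat.ListAction.Properties using (sum-↭)
open import Algebra.Properties.CommutativeSemigroup +-commutativeSemigroup using () renaming (interchange to +-interchange)
open import Data.Integer using (ℤ; 1ℤ; _⊖_; _⊔_; +≤+) renaming (_≤_ to _≤ᶻ_; _<_ to _<ᶻ_)
import Data.Integer.Properties as ℤ
open import Data.Bool using (if_then_else_)
open import Data.Fin using (Fin; zero; suc; fromℕ<) renaming (_≟_ to _≟ᶠ_)
open import Data.Fin.Properties using (any?; all?; ¬∀⟶∃¬; injective⇒≤)
open import Data.Fin.Subset using (Subset; inside; outside; ⊤; ∣_∣; _∪_; _─_; _-_; ⁅_⁆; ∁; _⊆_; Empty)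
  renaming (⊥ to ∅; _∈_ to _∈ₛ_; _∉_ to _∉ₛ_)
open import Data.Fin.Subset.Properties using (_⊆?_; nonempty?; anySubset?; drop-∷-⊆; ⊆-trans; ⊆⊤; ∉⊥;
  ∪-identityˡ; p⊆p∪q; q⊆p∪q; x∈p∪q⁻; x∈⁅y⁆⇒x≡y; ∣⁅x⁆∣≡1; p─q⊆p; x∈p∧x∉q⇒x∈p─q; x∈p∧x≢y⇒x∈p-y;
  x∉p⇒x∈∁p; x∈p⇒∣p-x∣<∣p∣; p⊆q⇒∣p∣≤∣q∣; ∣p∣≤n; ∣p∣≡n⇒p≡⊤)
  renaming (_∈?_ to _∈ₛ?_)
open import Data.Vec using ([]; _∷_; here; there)
open import Data.List using (List; []; _∷_; length; lookup; map; filter; concatMap; foldr)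
open import Data.List.Properties using (map-cong; filter-accept; filter-reject)
open import Data.List.Membership.Propositional using (_∈_; _∉_; find; lose)
open import Data.List.Membership.Propositional.Properties
  using (∈-map⁺; ∈-map⁻; ∈-++⁻; ∈-++⁺ˡ; ∈-concatMap⁺; ∈-concatMap⁻; ∈-deduplicate⁺; ∈-deduplicate⁻;
         ∈-filter⁺; ∈-filter⁻)
open import Data.List.Membership.Propositional.Properties.WithK using (unique∧set⇒bag)
import Data.List.Membership.DecPropositional as DecMembership
open DecMembership _≟_ using () renaming (_∈?_ to _∈ℕ?_)
open import Data.List.Relation.Unary.Any using (Any; here; there; index; satisfied)
open import Data.List.Relation.Unary.Any.Properties using (lookup-index)
open import Data.List.Relation.Unary.All as All using (All; []; _∷_)
open import Data.List.Relation.Unary.Unique.Propositional using (Unique; []; _∷_)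
open import Data.List.Relation.Unary.Unique.Propositional.Properties using (filter⁺)
open import Data.List.Relation.Unary.Unique.DecPropositional.Properties _≟_ using (deduplicate-!)
open import Data.List.Relation.Binary.Sublist.Propositional using ([]; _∷_; _∷ʳ_) renaming (_⊆_ to _⊑_)
open import Data.List.Relation.Binary.BagAndSetEquality using (∼bag⇒↭)
open import Data.List.Relation.Binary.Permutation.Propositional using (_↭_)
open import Data.List.Relation.Binary.Permutation.Propositional.Properties using (map⁺)
open import Data.Product using (∃; _×_; _,_; proj₁; proj₂)
open import Data.Product.Properties using (≡-dec)
open import Data.Sum using (_⊎_; inj₁; inj₂; [_,_])
open import Function using (_∘_; _∋_)
open import Function.Bundles using (_⇔_; mk⇔; Equivalence)
open import Relation.Nullary using (¬_; Dec; yes; no; does; contradiction)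
open import Relation.Nullary.Decidable using (_×-dec_; dec-true; dec-false)
open import Relation.Unary using (Decidable)
open import Relation.Binary.Definitions using (DecidableEquality)
open import Relation.Binary.PropositionalEquality
  using (_≡_; _≢_; refl; sym; trans; cong; cong₂; subst; subst₂; ≢-sym; module ≡-Reasoning)

module _ {A : Set} where

  sum-map-mono : ∀ {f g : A → ℕ} xs → (∀ x → f x ≤ g x) → sum (map f xs) ≤ sum (map g xs)
  sum-map-mono []       f≤g = z≤n
  sum-map-mono (x ∷ xs) f≤g = +-mono-≤ (f≤g x) (sum-map-mono xs f≤g)

  sum-map-+ : ∀ (f g : A → ℕ) xs → sum (map (λ x → f x + g x) xs) ≡ sum (map f xs) + sum (map g xs)
  sum-map-+ f g []       = refl
  sum-map-+ f g (x ∷ xs) rewrite sum-map-+ f g xs = +-interchange (f x) (g x) _ _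

  sum-map-filter : ∀ {P : A → Set} (P? : Decidable P) (g : A → ℕ) xs →
                   sum (map g (filter P? xs)) ≡ sum (map (λ x → if does (P? x) then g x else 0) xs)
  sum-map-filter P? g []       = refl
  sum-map-filter P? g (x ∷ xs) with P? x
  ... | yes _ = cong (g x +_) (sum-map-filter P? g xs)
  ... | no _  = sum-map-filter P? g xs

  sum-map-pos : ∀ (f : A → ℕ) xs → 0 < sum (map f xs) → Any (λ x → 0 < f x) xs
  sum-map-pos f (x ∷ xs) pos with f x in fx
  ... | suc _ = here (subst (0 <_) (sym fx) (s≤s z≤n))
  ... | zero  = there (sum-map-pos f xs pos)

module _ {A : Set} (_≟ᴬ_ : DecidableEquality A) where

  indicator : A → A → ℕ
  indicator y x = if does (x ≟ᴬ y) then 1 else 0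

  sum-indicator-∉ : ∀ {y} xs → All (y ≢_) xs → sum (map (indicator y) xs) ≡ 0
  sum-indicator-∉ []       []           = refl
  sum-indicator-∉ {y} (x ∷ xs) (y≢x ∷ y∉xs) with x ≟ᴬ y
  ... | yes x≡y = contradiction (sym x≡y) y≢x
  ... | no  _   = sum-indicator-∉ xs y∉xs

  sum-indicator-≤1 : ∀ y {xs} → Unique xs → sum (map (indicator y) xs) ≤ 1
  sum-indicator-≤1 y {[]}     []             = z≤n
  sum-indicator-≤1 y {x ∷ xs} (x∉xs ∷ uniq) with x ≟ᴬ y
  ... | yes refl = ≤-reflexive (cong suc (sum-indicator-∉ xs x∉xs))
  ... | no  _    = sum-indicator-≤1 y uniq

module _ {P : Set} (P? : Dec P) {A : Set} {a b : A} where

  if-yes : P → (if does P? then a else b) ≡ a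
  if-yes p = cong (λ c → if c then a else b) (dec-true P? p)

  if-no : ¬ P → (if does P? then a else b) ≡ b
  if-no ¬p = cong (λ c → if c then a else b) (dec-false P? ¬p)

m∸[1+n]≤m∸[1+o+n]+o : ∀ m n o → m ∸ suc n ≤ m ∸ suc (o + n) + o
m∸[1+n]≤m∸[1+o+n]+o m n o = begin
  m ∸ suc n             ≤⟨ m≤n+m∸n (m ∸ suc n) o ⟩
  o + (m ∸ suc n ∸ o)   ≡⟨ cong (o +_) (∸-+-assoc m (suc n) o) ⟩
  o + (m ∸ suc (n + o)) ≡⟨ +-comm o _ ⟩
  m ∸ suc (n + o) + o   ≡⟨ cong (λ k → m ∸ suc k + o) (+-comm n o) ⟩
  m ∸ suc (o + n) + o   ∎
  where open ≤-Reasoning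

∣p∪q∣≡∣p∣+∣q∣ : ∀ {n} (p q : Subset n) → q ⊆ ∁ p → ∣ p ∪ q ∣ ≡ ∣ p ∣ + ∣ q ∣
∣p∪q∣≡∣p∣+∣q∣ []            []            _    = refl
∣p∪q∣≡∣p∣+∣q∣ (inside  ∷ p) (inside  ∷ q) q⊆∁p = contradiction (q⊆∁p here) λ ()
∣p∪q∣≡∣p∣+∣q∣ (inside  ∷ p) (outside ∷ q) q⊆∁p = cong suc (∣p∪q∣≡∣p∣+∣q∣ p q (drop-∷-⊆ q⊆∁p))
∣p∪q∣≡∣p∣+∣q∣ (outside ∷ p) (inside  ∷ q) q⊆∁p =
  trans (cong suc (∣p∪q∣≡∣p∣+∣q∣ p q (drop-∷-⊆ q⊆∁p))) (sym (+-suc ∣ p ∣ ∣ q ∣))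
∣p∪q∣≡∣p∣+∣q∣ (outside ∷ p) (outside ∷ q) q⊆∁p = ∣p∪q∣≡∣p∣+∣q∣ p q (drop-∷-⊆ q⊆∁p)

∣p∣≡∣p─q∣+∣q∣ : ∀ {n} (p q : Subset n) → q ⊆ p → ∣ p ∣ ≡ ∣ p ─ q ∣ + ∣ q ∣
∣p∣≡∣p─q∣+∣q∣ []            []            _   = refl
∣p∣≡∣p─q∣+∣q∣ (inside  ∷ p) (inside  ∷ q) q⊆p =
  trans (cong suc (∣p∣≡∣p─q∣+∣q∣ p q (drop-∷-⊆ q⊆p))) (sym (+-suc ∣ p ─ q ∣ ∣ q ∣))
∣p∣≡∣p─q∣+∣q∣ (inside  ∷ p) (outside ∷ q) q⊆p = cong suc (∣p∣≡∣p─q∣+∣q∣ p q (drop-∷-⊆ q⊆p))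
∣p∣≡∣p─q∣+∣q∣ (outside ∷ p) (inside  ∷ q) q⊆p = contradiction (q⊆p here) λ ()
∣p∣≡∣p─q∣+∣q∣ (outside ∷ p) (outside ∷ q) q⊆p = ∣p∣≡∣p─q∣+∣q∣ p q (drop-∷-⊆ q⊆p)

x∈p─q⇒x∉q : ∀ {n} {x : Fin n} (p q : Subset n) → x ∈ₛ p ─ q → x ∉ₛ q
x∈p─q⇒x∉q (inside ∷ p) (outside ∷ q) here          ()
x∈p─q⇒x∉q (_      ∷ p) (_       ∷ q) (there x∈p─q) (there x∈q) = x∈p─q⇒x∉q p q x∈p─q x∈q

module _ {A : Set} where

  select : (xs : List A) → Subset (length xs) → List A
  select []       []            = []
  select (x ∷ xs) (inside  ∷ p) = x ∷ select xs p
  select (x ∷ xs) (outside ∷ p) = select xs p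

  select-⊑ : ∀ xs p → select xs p ⊑ xs
  select-⊑ []       []            = []
  select-⊑ (x ∷ xs) (inside  ∷ p) = refl ∷ select-⊑ xs p
  select-⊑ (x ∷ xs) (outside ∷ p) = x ∷ʳ select-⊑ xs p

  length-select : ∀ xs p → length (select xs p) ≡ ∣ p ∣
  length-select []       []            = refl
  length-select (x ∷ xs) (inside  ∷ p) = cong suc (length-select xs p)
  length-select (x ∷ xs) (outside ∷ p) = length-select xs p

  select-⊤ : ∀ xs → select xs ⊤ ≡ xs
  select-⊤ []       = refl
  select-⊤ (x ∷ xs) = cong (x ∷_) (select-⊤ xs)

  select-∅ : ∀ xs → select xs ∅ ≡ []
  select-∅ []       = refl
  select-∅ (x ∷ xs) = select-∅ xs

  Any-select⁻ : ∀ {P : A → Set} xs p → Any P (select xs p) → ∃ λ i → i ∈ₛ p × P (lookup xs i)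
  Any-select⁻ []       []            ()
  Any-select⁻ (x ∷ xs) (inside  ∷ p) (here px) = zero , here , px
  Any-select⁻ (x ∷ xs) (inside  ∷ p) (there a) with i , i∈p , pi ← Any-select⁻ xs p a = suc i , there i∈p , pi
  Any-select⁻ (x ∷ xs) (outside ∷ p) a         with i , i∈p , pi ← Any-select⁻ xs p a = suc i , there i∈p , pi

  Any-select⁺ : ∀ {P : A → Set} xs p {i} → i ∈ₛ p → P (lookup xs i) → Any P (select xs p)
  Any-select⁺ (x ∷ xs) (inside  ∷ p) {zero}  here        px = here px
  Any-select⁺ (x ∷ xs) (inside  ∷ p) {suc i} (there i∈p) px = there (Any-select⁺ xs p i∈p px)
  Any-select⁺ (x ∷ xs) (outside ∷ p) {suc i} (there i∈p) px = Any-select⁺ xs p i∈p px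

  All-select⁺ : ∀ {P : A → Set} xs p → (∀ {i} → i ∈ₛ p → P (lookup xs i)) → All P (select xs p)
  All-select⁺ []       []            all = []
  All-select⁺ (x ∷ xs) (inside  ∷ p) all = all here ∷ All-select⁺ xs p (λ i∈p → all (there i∈p))
  All-select⁺ (x ∷ xs) (outside ∷ p) all = All-select⁺ xs p (λ i∈p → all (there i∈p))

  All-select⁻ : ∀ {P : A → Set} xs p → All P (select xs p) → ∀ {i} → i ∈ₛ p → P (lookup xs i)
  All-select⁻ (x ∷ xs) (inside  ∷ p) (px ∷ all) here        = px
  All-select⁻ (x ∷ xs) (inside  ∷ p) (px ∷ all) (there i∈p) = All-select⁻ xs p all i∈p
  All-select⁻ (x ∷ xs) (outside ∷ p) all        (there i∈p) = All-select⁻ xs p all i∈p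

  ∈-sublists⁻ : ∀ xs {ys} → ys ∈ sublists xs → ∃ λ p → ys ≡ select xs p
  ∈-sublists⁻ []       (here refl) = [] , refl
  ∈-sublists⁻ (x ∷ xs) ys∈ with ∈-++⁻ (map (x ∷_) (sublists xs)) ys∈
  ... | inj₁ ys∈₁ with zs , zs∈ , refl ← ∈-map⁻ (x ∷_) ys∈₁ with p , refl ← ∈-sublists⁻ xs zs∈ =
    inside ∷ p , refl
  ... | inj₂ ys∈₂ with p , refl ← ∈-sublists⁻ xs ys∈₂ = outside ∷ p , refl

  ∈-sublists-self : (xs : List A) → xs ∈ sublists xs
  ∈-sublists-self []       = here refl
  ∈-sublists-self (x ∷ xs) = ∈-++⁺ˡ (∈-map⁺ (x ∷_) (∈-sublists-self xs))

module Literals (dom : Domains) where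

  open DecMembership {A = Literal dom} (≡-dec _≟_ _≟ᶠ_) using (_∈?_)

  forbidden : ℕ → List (Literal dom) → List (Literal dom)
  forbidden v = filter (λ l → v ≟ proj₁ l)

  length-forbidden-∷-≡ : ∀ v ε B → length (forbidden v ((v , ε) ∷ B)) ≡ suc (length (forbidden v B))
  length-forbidden-∷-≡ v ε B = cong length (filter-accept (λ l → v ≟ proj₁ l) refl)

  length-forbidden-∷-≢ : ∀ {w v} → w ≢ v → ∀ ε B →
                         length (forbidden w ((v , ε) ∷ B)) ≡ length (forbidden w B)
  length-forbidden-∷-≢ {w} w≢v ε B = cong length (filter-reject (λ l → w ≟ proj₁ l) w≢v)

  length-forbidden-∷ : ∀ w v ε B →
                       length (forbidden w ((v , ε) ∷ B)) ≡ indicator _≟_ v w + length (forbidden w B)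
  length-forbidden-∷ w v ε B with w ≟ v
  ... | yes refl = trans (length-forbidden-∷-≡ w ε B)
                         (cong (_+ length (forbidden w B)) (sym (if-yes (w ≟ w) refl)))
  ... | no  w≢v  = trans (length-forbidden-∷-≢ w≢v ε B)
                         (cong (_+ length (forbidden w B)) (sym (if-no (w ≟ v) w≢v)))

  all-forbidden⇒≤ : ∀ v B → (∀ e → (v , e) ∈ B) → dom v ≤ length (forbidden v B)
  all-forbidden⇒≤ v B all = injective⇒≤ {f = position} position-injective
    where
    forbids : ∀ e → (v , e) ∈ forbidden v B
    forbids e = ∈-filter⁺ (λ l → v ≟ proj₁ l) (all e) refl
    position : Fin (dom v) → Fin (length (forbidden v B))
    position e = index (forbids e)
    value-injective : ∀ {e e′} → (Literal dom ∋ (v , e)) ≡ (v , e′) → e ≡ e′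
    value-injective refl = refl
    position-injective : ∀ {e e′} → position e ≡ position e′ → e ≡ e′
    position-injective {e} {e′} same = value-injective (begin
      (v , e)                                ≡⟨ lookup-index (forbids e) ⟩
      lookup (forbidden v B) (position e)    ≡⟨ cong (lookup (forbidden v B)) same ⟩
      lookup (forbidden v B) (position e′)   ≡⟨ lookup-index (forbids e′) ⟨
      (v , e′)                               ∎)
      where open ≡-Reasoning

  ∃-value-∉ : ∀ v B → length (forbidden v B) < dom v → ∃ λ (e : Fin (dom v)) → (v , e) ∉ B
  ∃-value-∉ v B few with all? (λ e → (v , e) ∈? B)
  ... | no  ¬all = ¬∀⟶∃¬ (dom v) _ (λ e → (v , e) ∈? B) ¬all
  ... | yes all  = contradiction (all-forbidden⇒≤ v B all) (<⇒≱ few)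

⊖-<-⊖ : ∀ {a b c d} → d + a < b + c → a ⊖ b <ᶻ c ⊖ d
⊖-<-⊖ {a} {b} {c} {d} lt = begin-strict
  a ⊖ b                ≡⟨ ℤ.+-cancelˡ-⊖ d a b ⟨
  (d + a) ⊖ (d + b)    <⟨ ℤ.⊖-monoˡ-< (d + b) lt ⟩
  (b + c) ⊖ (d + b)    ≡⟨ cong ((b + c) ⊖_) (+-comm d b) ⟩
  (b + c) ⊖ (b + d)    ≡⟨ ℤ.+-cancelˡ-⊖ b c d ⟩
  c ⊖ d                ∎
  where open ℤ.≤-Reasoning

δ-<-δ : ∀ {dom} (G H : ClauseSet dom) → rd dom H + c dom G < rd dom G + c dom H → δ dom G <ᶻ δ dom H
δ-<-δ {dom} G H lt = subst₂ _<ᶻ_ (sym (ℤ.m-n≡m⊖n (c dom G) (rd dom G))) (sym (ℤ.m-n≡m⊖n (c dom H) (rd dom H)))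
                       (⊖-<-⊖ {c dom G} {rd dom G} lt)

foldr-⊔-lub : ∀ {z x} xs → z ≤ᶻ x → All (_≤ᶻ x) xs → foldr _⊔_ z xs ≤ᶻ x
foldr-⊔-lub []       z≤x []           = z≤x
foldr-⊔-lub (y ∷ xs) z≤x (y≤x ∷ xs≤x) = ℤ.⊔-lub y≤x (foldr-⊔-lub xs z≤x xs≤x)

foldr-⊔-≡-greatest : ∀ {z x} xs → z ≤ᶻ x → All (_≤ᶻ x) xs → x ∈ xs → foldr _⊔_ z xs ≡ x
foldr-⊔-≡-greatest (y ∷ xs) z≤x (y≤x ∷ xs≤x) (here refl)  = ℤ.i≥j⇒i⊔j≡i (foldr-⊔-lub xs z≤x xs≤x)
foldr-⊔-≡-greatest (y ∷ xs) z≤x (y≤x ∷ xs≤x) (there x∈xs) =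
  trans (cong (y ⊔_) (foldr-⊔-≡-greatest xs z≤x xs≤x x∈xs)) (ℤ.i≤j⇒i⊔j≡j y≤x)

SatClause-cong : ∀ {dom} {φ ψ : Assignment dom} (C : Clause dom) →
                 (∀ {l} → l ∈ C → ψ (proj₁ l) ≡ φ (proj₁ l)) → SatClause dom φ C → SatClause dom ψ C
SatClause-cong C agree sat with l , l∈C , φl≢ ← find sat =
  lose l∈C (λ ψl≡ → φl≢ (trans (sym (agree l∈C)) ψl≡))

module Hall (dom : Domains) (F : ClauseSet dom) where

  open Literals dom

  m : ℕ
  m = length F

  clause : Fin m → Clause dom
  clause = lookup F

  Occurs : ℕ → Subset m → Set
  Occurs v t = ∃ λ i → i ∈ₛ t × v ∈ map proj₁ (clause i)

  occurs? : ∀ v t → Dec (Occurs v t)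
  occurs? v t = any? (λ i → i ∈ₛ? t ×-dec v ∈ℕ? map proj₁ (clause i))

  occurs-mono : ∀ {v p q} → p ⊆ q → Occurs v p → Occurs v q
  occurs-mono p⊆q (i , i∈p , v∈i) = i , p⊆q i∈p , v∈i

  occurs-∪⁻ : ∀ {v} p q → Occurs v (p ∪ q) → Occurs v p ⊎ Occurs v q
  occurs-∪⁻ p q (i , i∈p∪q , v∈i) with x∈p∪q⁻ p q i∈p∪q
  ... | inj₁ i∈p = inj₁ (i , i∈p , v∈i)
  ... | inj₂ i∈q = inj₂ (i , i∈q , v∈i)

  ¬occurs-∅ : ∀ {v} → ¬ Occurs v ∅
  ¬occurs-∅ (i , i∈∅ , _) = ∉⊥ i∈∅

  occurs-literal : ∀ {l i t} → l ∈ clause i → i ∈ₛ t → Occurs (proj₁ l) t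
  occurs-literal l∈i i∈t = _ , i∈t , ∈-map⁺ proj₁ l∈i

  occurs-⁅⁆ : ∀ {v i} → Occurs v ⁅ i ⁆ → ∃ λ ε → (v , ε) ∈ clause i
  occurs-⁅⁆ (j , j∈⁅i⁆ , v∈j) with x∈⁅y⁆⇒x≡y _ j∈⁅i⁆
  ... | refl with (_ , ε) , l∈j , refl ← ∈-map⁻ proj₁ v∈j = ε , l∈j

  V : List ℕ
  V = vars dom F

  V-unique : Unique V
  V-unique = deduplicate-! (concatMap (map proj₁) F)

  -- In the Hall-type theorem `hall` the variables occurring in the clauses u are frozen, and
  -- (v , ε) ∈ B records that v already serves a clause through the literal v ≠ ε. An unfrozen v can
  -- then serve slack u B v further clauses.
  slack : Subset m → List (Literal dom) → ℕ → ℕ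
  slack u B v = if does (occurs? v u) then 0 else dom v ∸ suc (length (forbidden v B))

  contribution : Subset m → List (Literal dom) → Subset m → ℕ → ℕ
  contribution u B t v = if does (occurs? v t) then slack u B v else 0

  capacity : Subset m → List (Literal dom) → Subset m → ℕ
  capacity u B t = sum (map (contribution u B t) V)

  slack-∪ : ∀ {v} u h B → ¬ Occurs v h → slack (u ∪ h) B v ≡ slack u B v
  slack-∪ {v} u h B ¬vh with occurs? v u | occurs? v (u ∪ h)
  ... | yes _  | yes _    = refl
  ... | yes vu | no ¬vuh  = contradiction (occurs-mono (p⊆p∪q h) vu) ¬vuh
  ... | no ¬vu | yes vuh  = contradiction (occurs-∪⁻ u h vuh) [ ¬vu , ¬vh ]
  ... | no _   | no _     = refl

  slack-frozen : ∀ {v u} B → Occurs v u → slack u B v ≡ 0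
  slack-frozen {v} {u} B vu with occurs? v u
  ... | yes _   = refl
  ... | no ¬vu  = contradiction vu ¬vu

  contribution-frozen : ∀ {v u} B t → Occurs v u → contribution u B t v ≡ 0
  contribution-frozen {v} B t vu with occurs? v t
  ... | yes _ = slack-frozen B vu
  ... | no _  = refl

  capacity-∪ : ∀ u B h t → capacity u B (h ∪ t) ≡ capacity u B h + capacity (u ∪ h) B t
  capacity-∪ u B h t = trans (cong sum (map-cong pointwise V)) (sum-map-+ _ _ V)
    where
    pointwise : ∀ v → contribution u B (h ∪ t) v ≡ contribution u B h v + contribution (u ∪ h) B t v
    pointwise v with occurs? v h | occurs? v (h ∪ t)
    ... | yes vh | yes _   = sym (trans (cong (slack u B v +_) (contribution-frozen B t (occurs-mono (q⊆p∪q u h) vh)))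
                                        (+-identityʳ _))
    ... | yes vh | no ¬vht = contradiction (occurs-mono (p⊆p∪q t) vh) ¬vht
    ... | no ¬vh | yes vht with occurs? v t
    ...   | yes _  = sym (slack-∪ u h B ¬vh)
    ...   | no ¬vt = contradiction (occurs-∪⁻ h t vht) [ ¬vh , ¬vt ]
    pointwise v | no _ | no ¬vht with occurs? v t
    ...   | yes vt = contradiction (occurs-mono (q⊆p∪q h t) vt) ¬vht
    ...   | no _   = refl

  slack-∷ : ∀ u B v ε w → slack u B w ≤ slack u ((v , ε) ∷ B) w + indicator _≟_ v w
  slack-∷ u B v ε w with occurs? w u
  ... | yes _ = z≤n
  ... | no _  = begin
    dom w ∸ suc (length (forbidden w B))
      ≤⟨ m∸[1+n]≤m∸[1+o+n]+o (dom w) (length (forbidden w B)) (indicator _≟_ v w) ⟩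
    dom w ∸ suc (indicator _≟_ v w + length (forbidden w B)) + _
      ≡⟨ cong (λ k → dom w ∸ suc k + _) (length-forbidden-∷ w v ε B) ⟨
    dom w ∸ suc (length (forbidden w ((v , ε) ∷ B))) + _
      ∎
    where open ≤-Reasoning

  capacity-∷ : ∀ u B v ε t → capacity u B t ≤ suc (capacity u ((v , ε) ∷ B) t)
  capacity-∷ u B v ε t = begin
    capacity u B t
      ≤⟨ sum-map-mono V pointwise ⟩
    sum (map (λ w → contribution u ((v , ε) ∷ B) t w + indicator _≟_ v w) V)
      ≡⟨ sum-map-+ _ _ V ⟩
    capacity u ((v , ε) ∷ B) t + sum (map (indicator _≟_ v) V)
      ≤⟨ +-monoʳ-≤ _ (sum-indicator-≤1 _≟_ v V-unique) ⟩
    capacity u ((v , ε) ∷ B) t + 1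
      ≡⟨ +-comm _ 1 ⟩
    suc (capacity u ((v , ε) ∷ B) t)
      ∎
    where
    open ≤-Reasoning
    pointwise : ∀ w → contribution u B t w ≤ contribution u ((v , ε) ∷ B) t w + indicator _≟_ v w
    pointwise w with occurs? w t
    ... | yes _ = slack-∷ u B v ε w
    ... | no _  = z≤n

  capacity-positive : ∀ u B t → 0 < capacity u B t →
                      ∃ λ v → Occurs v t × ¬ Occurs v u × suc (length (forbidden v B)) < dom v
  capacity-positive u B t pos with v , pos-v ← satisfied (sum-map-pos _ V pos) with occurs? v t
  ... | no _   = contradiction pos-v (<-irrefl refl)
  ... | yes vt with occurs? v u
  ...   | yes _  = contradiction pos-v (<-irrefl refl)
  ...   | no ¬vu = v , vt , ¬vu , m∸n≢0⇒n<m (≢-sym (<⇒≢ pos-v))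

  ∈-vars-select⇔ : ∀ {v} t → v ∈ vars dom (select F t) ⇔ Occurs v t
  ∈-vars-select⇔ t = mk⇔
    (λ v∈ → Any-select⁻ F t (∈-concatMap⁻ (map proj₁) (∈-deduplicate⁻ _≟_ _ v∈)))
    (λ (i , i∈t , v∈i) → ∈-deduplicate⁺ _≟_ (∈-concatMap⁺ (map proj₁) (Any-select⁺ F t i∈t v∈i)))

  occurs⇒∈V : ∀ {v t} → Occurs v t → v ∈ V
  occurs⇒∈V vt =
    subst (λ G → _ ∈ vars dom G) (select-⊤ F) (Equivalence.from (∈-vars-select⇔ ⊤) (occurs-mono ⊆⊤ vt))

  rd-select : ∀ t → rd dom (select F t) ≡ capacity ∅ [] t
  rd-select t = begin
    sum (map (λ v → dom v ∸ 1) (vars dom (select F t)))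
      ≡⟨ sum-↭ (map⁺ _ vars↭) ⟩
    sum (map (λ v → dom v ∸ 1) (filter (λ v → occurs? v t) V))
      ≡⟨ sum-map-filter (λ v → occurs? v t) _ V ⟩
    sum (map (λ v → if does (occurs? v t) then dom v ∸ 1 else 0) V)
      ≡⟨ cong sum (map-cong unfrozen V) ⟨
    capacity ∅ [] t
      ∎
    where
    open ≡-Reasoning
    vars↭ : vars dom (select F t) ↭ filter (λ v → occurs? v t) V
    vars↭ = ∼bag⇒↭ (unique∧set⇒bag (deduplicate-! (concatMap (map proj₁) (select F t)))
                                    (filter⁺ (λ v → occurs? v t) V-unique)
      (mk⇔ (λ v∈ → let vt = Equivalence.to (∈-vars-select⇔ t) v∈ in ∈-filter⁺ (λ v → occurs? v t) (occurs⇒∈V vt) vt)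
           (λ v∈ → Equivalence.from (∈-vars-select⇔ t) (proj₂ (∈-filter⁻ (λ v → occurs? v t) {xs = V} v∈)))))
    unfrozen : ∀ v → contribution ∅ [] t v ≡ (if does (occurs? v t) then dom v ∸ 1 else 0)
    unfrozen v with occurs? v ∅
    ... | yes v∅ = contradiction v∅ ¬occurs-∅
    ... | no _   = refl

  capacity-∪-∅ : ∀ s t → capacity ∅ [] (s ∪ t) ≡ capacity ∅ [] s + capacity s [] t
  capacity-∪-∅ s t = trans (capacity-∪ ∅ [] s t) (cong (λ u → capacity ∅ [] s + capacity u [] t) (∪-identityˡ s))

  Agrees : Subset m → Assignment dom → Assignment dom → Set
  Agrees u φ ψ = ∀ {v} → Occurs v u → ψ v ≡ φ v

  Avoids : Subset m → List (Literal dom) → Assignment dom → Set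
  Avoids u B ψ = ∀ {v ε} → (v , ε) ∈ B → ¬ Occurs v u → ψ v ≢ ε

  Satisfies : Assignment dom → Subset m → Set
  Satisfies ψ s = ∀ {i} → i ∈ₛ s → SatClause dom ψ (clause i)

  record Extension (u : Subset m) (B : List (Literal dom)) (φ : Assignment dom) (s : Subset m) : Set where
    field
      ψ         : Assignment dom
      agrees    : Agrees u φ ψ
      avoids    : Avoids u B ψ
      satisfies : Satisfies ψ s

  Fresh : Subset m → List (Literal dom) → Set
  Fresh u B = ∀ v → ¬ Occurs v u → length (forbidden v B) < dom v

  HallCondition : Subset m → List (Literal dom) → Subset m → Set
  HallCondition u B s = ∀ t → t ⊆ s → ∣ t ∣ ≤ capacity u B t

  fresh-∷ : ∀ {u B v} ε → Fresh u B → suc (length (forbidden v B)) < dom v → Fresh u ((v , ε) ∷ B)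
  fresh-∷ {B = B} {v} ε fresh room w ¬wu with w ≟ v
  ... | yes refl = subst (_< dom w) (sym (length-forbidden-∷-≡ w ε B)) room
  ... | no  w≢v  = subst (_< dom w) (sym (length-forbidden-∷-≢ w≢v ε B)) (fresh w ¬wu)

  avoiding : ∀ {u B} → Fresh u B → Assignment dom → Assignment dom
  avoiding {u} {B} fresh φ v with occurs? v u
  ... | yes _  = φ v
  ... | no ¬vu = proj₁ (∃-value-∉ v B (fresh v ¬vu))

  extension-∅ : ∀ {u B} φ {s} → Fresh u B → Empty s → Extension u B φ s
  extension-∅ {u} {B} φ fresh empty = record
    { ψ = avoiding fresh φ ; agrees = agrees ; avoids = avoids ; satisfies = λ i∈s → contradiction (_ , i∈s) empty }
    where
    agrees : Agrees u φ (avoiding fresh φ)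
    agrees {v} vu with occurs? v u
    ... | yes _  = refl
    ... | no ¬vu = contradiction vu ¬vu
    avoids : Avoids u B (avoiding fresh φ)
    avoids {v} vε∈B ¬vu with occurs? v u
    ... | yes vu  = contradiction vu ¬vu
    ... | no ¬vu′ = λ { refl → proj₂ (∃-value-∉ v B (fresh v ¬vu′)) vε∈B }

  capacity-⁅⁆ : ∀ u B {s i} → HallCondition u B s → i ∈ₛ s → 0 < capacity u B ⁅ i ⁆
  capacity-⁅⁆ u B {s} {i} hall i∈s =
    subst (_≤ capacity u B ⁅ i ⁆) (∣⁅x⁆∣≡1 i)
          (hall ⁅ i ⁆ (λ j∈⁅i⁆ → subst (_∈ₛ s) (sym (x∈⁅y⁆⇒x≡y i j∈⁅i⁆)) i∈s))

  HallExtends : ℕ → Set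
  HallExtends n = ∀ {u B} φ s → ∣ s ∣ ≤ n → Fresh u B → HallCondition u B s → Extension u B φ s

  extend-via-clause : ∀ {n} → HallExtends n → ∀ {u B} φ s {i} → i ∈ₛ s → ∣ s ∣ ≤ suc n →
                      Fresh u B → HallCondition u B s →
                      (∀ t → t ⊆ s - i → 0 < ∣ t ∣ → ∣ t ∣ < capacity u B t) → Extension u B φ s
  extend-via-clause ih {u} {B} φ s {i} i∈s ∣s∣≤1+n fresh hall loose
    with v , vi , ¬vu , room ← capacity-positive u B ⁅ i ⁆ (capacity-⁅⁆ u B hall i∈s)
    with ε , vε∈i ← occurs-⁅⁆ vi
    = record { ψ = ψ ; agrees = agrees ; avoids = λ vε′∈B → avoids (there vε′∈B) ; satisfies = satisfies′ }
    where
    hall′ : HallCondition u ((v , ε) ∷ B) (s - i)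
    hall′ t t⊆s-i with 0 <? ∣ t ∣
    ... | yes pos = ≤-pred (<-≤-trans (loose t t⊆s-i pos) (capacity-∷ u B v ε t))
    ... | no ¬pos = ≤-trans (≮⇒≥ ¬pos) z≤n
    E : Extension u ((v , ε) ∷ B) φ (s - i)
    E = ih φ (s - i) (≤-pred (<-≤-trans (x∈p⇒∣p-x∣<∣p∣ i∈s) ∣s∣≤1+n)) (fresh-∷ ε fresh room) hall′
    open Extension E
    satisfies′ : Satisfies ψ s
    satisfies′ {j} j∈s with j ≟ᶠ i
    ... | yes refl = lose vε∈i (avoids (here refl) ¬vu)
    ... | no  j≢i  = satisfies (x∈p∧x≢y⇒x∈p-y j∈s j≢i)

  extend-via-tight : ∀ {n} → HallExtends n → ∀ {u B} φ s {h} → ∣ s ∣ ≤ suc n →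
                     Fresh u B → HallCondition u B s →
                     h ⊆ s → 0 < ∣ h ∣ → ∣ h ∣ < ∣ s ∣ → capacity u B h ≤ ∣ h ∣ → Extension u B φ s
  extend-via-tight ih {u} {B} φ s {h} ∣s∣≤1+n fresh hall h⊆s h-nonempty h⊂s tight = record
    { ψ = E₂.ψ ; agrees = agrees ; avoids = avoids ; satisfies = satisfies }
    where
    E₁ : Extension u B φ h
    E₁ = ih φ h (≤-pred (<-≤-trans h⊂s ∣s∣≤1+n)) fresh (λ t t⊆h → hall t (⊆-trans t⊆h h⊆s))
    module E₁ = Extension E₁

    ∣s─h∣<∣s∣ : ∣ s ─ h ∣ < ∣ s ∣
    ∣s─h∣<∣s∣ = begin-strict
      ∣ s ─ h ∣          <⟨ m<m+n _ h-nonempty ⟩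
      ∣ s ─ h ∣ + ∣ h ∣  ≡⟨ ∣p∣≡∣p─q∣+∣q∣ s h h⊆s ⟨
      ∣ s ∣              ∎
      where open ≤-Reasoning

    hall′ : HallCondition (u ∪ h) B (s ─ h)
    hall′ t t⊆s─h = +-cancelˡ-≤ ∣ h ∣ _ _ (begin
      ∣ h ∣ + ∣ t ∣                            ≡⟨ ∣p∪q∣≡∣p∣+∣q∣ h t (λ x∈t → x∉p⇒x∈∁p (x∈p─q⇒x∉q s h (t⊆s─h x∈t))) ⟨
      ∣ h ∪ t ∣                                ≤⟨ hall (h ∪ t) h∪t⊆s ⟩
      capacity u B (h ∪ t)                     ≡⟨ capacity-∪ u B h t ⟩
      capacity u B h + capacity (u ∪ h) B t    ≤⟨ +-monoˡ-≤ _ tight ⟩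
      ∣ h ∣ + capacity (u ∪ h) B t             ∎)
      where
      open ≤-Reasoning
      h∪t⊆s : h ∪ t ⊆ s
      h∪t⊆s x∈h∪t = [ h⊆s , p─q⊆p s h ∘ t⊆s─h ] (x∈p∪q⁻ h t x∈h∪t)

    E₂ : Extension (u ∪ h) B E₁.ψ (s ─ h)
    E₂ = ih E₁.ψ (s ─ h) (≤-pred (<-≤-trans ∣s─h∣<∣s∣ ∣s∣≤1+n))
            (λ v ¬vuh → fresh v (¬vuh ∘ occurs-mono (p⊆p∪q h))) hall′
    module E₂ = Extension E₂

    agrees : Agrees u φ E₂.ψ
    agrees vu = trans (E₂.agrees (occurs-mono (p⊆p∪q h) vu)) (E₁.agrees vu)

    avoids : Avoids u B E₂.ψ
    avoids {v} vε∈B ¬vu with occurs? v h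
    ... | yes vh  = λ ψ₂v≡ε →
      E₁.avoids vε∈B ¬vu (trans (sym (E₂.agrees (occurs-mono (q⊆p∪q u h) vh))) ψ₂v≡ε)
    ... | no  ¬vh = E₂.avoids vε∈B (λ vuh → [ ¬vu , ¬vh ] (occurs-∪⁻ u h vuh))

    satisfies : Satisfies E₂.ψ s
    satisfies {j} j∈s with j ∈ₛ? h
    ... | yes j∈h = SatClause-cong (clause j)
                      (λ l∈j → E₂.agrees (occurs-mono (q⊆p∪q u h) (occurs-literal l∈j j∈h))) (E₁.satisfies j∈h)
    ... | no  j∉h = E₂.satisfies (x∈p∧x∉q⇒x∈p─q j∈s j∉h)

  -- Fix a clause i of s. If a nonempty part h of s - i is tight, satisfy h first and freeze its
  -- variables; otherwise every such part has spare capacity, which clause i may use up one unit of.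
  hall : ∀ n → HallExtends n
  hall n {u} {B} φ s ∣s∣≤n fresh cond with nonempty? s
  ... | no  empty    = extension-∅ φ fresh empty
  ... | yes (i , i∈s) with n
  ...   | zero   = contradiction ∣s∣≤n (<⇒≱ (≤-<-trans z≤n (x∈p⇒∣p-x∣<∣p∣ i∈s)))
  ...   | suc n′ with anySubset? (λ t → t ⊆? s - i ×-dec 0 <? ∣ t ∣ ×-dec capacity u B t ≤? ∣ t ∣)
  ...     | yes (h , h⊆s-i , h-nonempty , tight) =
            extend-via-tight (hall n′) φ s ∣s∣≤n fresh cond (⊆-trans h⊆s-i (p─q⊆p s ⁅ i ⁆)) h-nonempty
              (≤-<-trans (p⊆q⇒∣p∣≤∣q∣ h⊆s-i) (x∈p⇒∣p-x∣<∣p∣ i∈s)) tight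
  ...     | no  ¬tight = extend-via-clause (hall n′) φ s i∈s ∣s∣≤n fresh cond
                           (λ t t⊆s-i pos → ≰⇒> (λ cap≤ → ¬tight (t , t⊆s-i , pos , cap≤)))

  deficient-extension : (∀ v → NonZero (dom v)) → ∀ s → Satisfiable dom (select F s) → ¬ Satisfiable dom F →
                        ∃ λ t → t ⊆ ∁ s × capacity s [] t < ∣ t ∣
  deficient-extension nonzero s (φ , φ⊨s) unsat
    with anySubset? (λ t → t ⊆? ∁ s ×-dec capacity s [] t <? ∣ t ∣)
  ... | yes deficient = deficient
  ... | no ¬deficient =
    contradiction (ψ , subst (All (SatClause dom ψ)) (select-⊤ F) (All-select⁺ F ⊤ λ {i} _ → ψ⊨ i)) unsat
    where
    E : Extension s [] φ (∁ s)
    E = hall _ φ (∁ s) ≤-refl (λ v _ → >-nonZero⁻¹ (dom v) {{nonzero v}})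
          (λ t t⊆∁s → ≮⇒≥ (λ cap<∣t∣ → ¬deficient (t , t⊆∁s , cap<∣t∣)))
    open Extension E
    ψ⊨ : ∀ i → SatClause dom ψ (clause i)
    ψ⊨ i with i ∈ₛ? s
    ... | yes i∈s = SatClause-cong (clause i) (λ l∈i → agrees (occurs-literal l∈i i∈s)) (All-select⁻ F s φ⊨s i∈s)
    ... | no  i∉s = satisfies (x∉p⇒x∈∁p i∉s)

module MinimallyUnsatisfiable (dom : Domains) (nonzero : ∀ v → NonZero (dom v))
                              (F : ClauseSet dom) (mu : MinUnsat dom F) where

  open Hall dom F

  δₛ : Subset m → ℤ
  δₛ s = δ dom (select F s)

  δ-increase : ∀ s t → t ⊆ ∁ s → capacity s [] t < ∣ t ∣ → δₛ s <ᶻ δₛ (s ∪ t)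
  δ-increase s t t⊆∁s deficient = δ-<-δ (select F s) (select F (s ∪ t)) (begin-strict
    rd dom (select F (s ∪ t)) + length (select F s)   ≡⟨ cong₂ _+_ rd-∪ (length-select F s) ⟩
    (r + capacity s [] t) + ∣ s ∣                     ≡⟨ +-assoc r _ _ ⟩
    r + (capacity s [] t + ∣ s ∣)                     ≡⟨ cong (r +_) (+-comm _ ∣ s ∣) ⟩
    r + (∣ s ∣ + capacity s [] t)                     <⟨ +-monoʳ-< r (+-monoʳ-< ∣ s ∣ deficient) ⟩
    r + (∣ s ∣ + ∣ t ∣)                               ≡⟨ cong (r +_) (∣p∪q∣≡∣p∣+∣q∣ s t t⊆∁s) ⟨
    r + ∣ s ∪ t ∣                                     ≡⟨ cong (r +_) (length-select F (s ∪ t)) ⟨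
    r + length (select F (s ∪ t))                     ∎)
    where
    open ≤-Reasoning
    r = rd dom (select F s)
    rd-∪ : rd dom (select F (s ∪ t)) ≡ r + capacity s [] t
    rd-∪ = trans (rd-select (s ∪ t)) (trans (capacity-∪-∅ s t) (cong (_+ capacity s [] t) (sym (rd-select s))))

  proper-satisfiable : ∀ s → ∣ s ∣ < m → Satisfiable dom (select F s)
  proper-satisfiable s ∣s∣<m = proj₂ mu (select F s) (select-⊑ F s) (subst (_< m) (sym (length-select F s)) ∣s∣<m)

  δ-maximal : ∀ s → δₛ ⊤ ≤ᶻ δₛ s → s ≡ ⊤
  δ-maximal s = go m s (m≤n+m m ∣ s ∣)
    where
    go : ∀ k s → m ≤ ∣ s ∣ + k → δₛ ⊤ ≤ᶻ δₛ s → s ≡ ⊤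
    go zero    s m≤∣s∣+0 _ = ∣p∣≡n⇒p≡⊤ (≤-antisym (∣p∣≤n s) (subst (m ≤_) (+-identityʳ _) m≤∣s∣+0))
    go (suc k) s m≤∣s∣+1+k δ⊤≤δs with ∣ s ∣ ≟ m
    ... | yes ∣s∣≡m = ∣p∣≡n⇒p≡⊤ ∣s∣≡m
    ... | no  ∣s∣≢m
      with t , t⊆∁s , deficient ←
             deficient-extension nonzero s (proper-satisfiable s (≤∧≢⇒< (∣p∣≤n s) ∣s∣≢m)) (proj₁ mu)
      = contradiction (subst (λ p → δₛ ⊤ <ᶻ δₛ p) (go k (s ∪ t) m≤∣s∪t∣+k (ℤ.<⇒≤ δ⊤<δs∪t)) δ⊤<δs∪t)
                      (ℤ.<-irrefl refl)
      where
      δ⊤<δs∪t : δₛ ⊤ <ᶻ δₛ (s ∪ t)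
      δ⊤<δs∪t = ℤ.≤-<-trans δ⊤≤δs (δ-increase s t t⊆∁s deficient)
      m≤∣s∪t∣+k : m ≤ ∣ s ∪ t ∣ + k
      m≤∣s∪t∣+k = begin
        m                      ≤⟨ m≤∣s∣+1+k ⟩
        ∣ s ∣ + suc k          ≡⟨ +-suc ∣ s ∣ k ⟩
        suc ∣ s ∣ + k          ≤⟨ +-monoˡ-≤ k (m<m+n ∣ s ∣ (≤-<-trans z≤n deficient)) ⟩
        (∣ s ∣ + ∣ t ∣) + k    ≡⟨ cong (_+ k) (∣p∪q∣≡∣p∣+∣q∣ s t t⊆∁s) ⟨
        ∣ s ∪ t ∣ + k          ∎
        where open ≤-Reasoning

  δ-select-≤ : ∀ s → δₛ s ≤ᶻ δ dom F
  δ-select-≤ s with ℤ.≤-total (δₛ s) (δₛ ⊤)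
  ... | inj₁ δs≤δ⊤ = subst (δₛ s ≤ᶻ_) (cong (δ dom) (select-⊤ F)) δs≤δ⊤
  ... | inj₂ δ⊤≤δs = ℤ.≤-reflexive (trans (cong δₛ (δ-maximal s δ⊤≤δs)) (cong (δ dom) (select-⊤ F)))

  δ-positive : 1ℤ ≤ᶻ δ dom F
  δ-positive = ℤ.i<j⇒suc[i]≤j (subst₂ _<ᶻ_ (cong (δ dom) (select-∅ F)) (cong (δ dom) (select-⊤ F))
                 (ℤ.≰⇒> (proj₁ mu ∘ F-satisfiable ∘ δ-maximal ∅)))
    where
    F-satisfiable : ∅ ≡ ⊤ → Satisfiable dom F
    F-satisfiable ∅≡⊤ =
      subst (Satisfiable dom) (trans (sym (select-∅ F)) (trans (cong (select F) ∅≡⊤) (select-⊤ F)))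
            ((λ v → fromℕ< (>-nonZero⁻¹ (dom v) {{nonzero v}})) , [])

corollary1p9p9 : (dom : Domains) → (∀ v → NonZero (dom v)) →
    (F : ClauseSet dom) → WFClauseSet dom F → MinUnsat dom F →
    (δ* dom F ≡ δ dom F) × (1ℤ ≤ᶻ δ dom F)
corollary1p9p9 dom nonzero F _ mu = δ*≡δ , δ-positive
  where
  open MinimallyUnsatisfiable dom nonzero F mu
  bounded : ∀ {x} → x ∈ map (δ dom) (sublists F) → x ≤ᶻ δ dom F
  bounded x∈ with G , G∈ , refl ← ∈-map⁻ (δ dom) x∈ with s , refl ← ∈-sublists⁻ F G∈ = δ-select-≤ s
  δ*≡δ : δ* dom F ≡ δ dom F
  δ*≡δ = foldr-⊔-≡-greatest _ (ℤ.≤-trans (+≤+ z≤n) δ-positive) (All.tabulate bounded)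
                             (∈-map⁺ (δ dom) (∈-sublists-self F))
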